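{- For every integer $n\geqslant 2$, $$b_n(x,y)=(1+y)\sum_{k\geqslant 0}4^k\xi(n,k)(xy)^k(1+xy)^{n-1-2k}+y(1+x)\sum_{k\geqslant 0}4^k\zeta(n,k)(xy)^{k}(1+xy)^{n-2-2k},$$ where $\xi(n,k)=T(n,2k+1)$ and $\zeta(n,k)=2T(n,2k+2)$.
   Context: $\mathfrak{S}_n^B$ is the hyperoctahedral group of signed permutations $\pi=\pi(1)\cdots\pi(n)$ of $\pm[n]$ (with $\pi(-i)=-\pi(i)$). For $\pi\in\mathfrak{S}_n^B$: $\operatorname{des}_A(\pi)=\#\{i\in\{1,\ldots,n-1\}:\pi(i)>\pi(i+1)\}$ and $\operatorname{des}_B(\pi)=\#\{i\in\{0,1,\ldots,n-1\}:\pi(i)>\pi(i+1)\}$ with the convention $\pi(0)=0$. Set $b_n(x,y)=\sum_{\pi\in\mathfrak{S}_n^B}x^{\operatorname{des}_A(\pi)}y^{\operatorname{des}_B(\pi)}$. For an ordinary permutation $\pi\in\mathfrak{S}_n$, the number of up-down runs $\mathrm{udrun}(\pi)$ is the number of maximal contiguous monotone (increasing or decreasing) runs of the word $0\pi(1)\pi(2)\cdots\pi(n)$; equivalently, with $\pi(0)=0$, $\mathrm{udrun}(\pi)=1+\#\{i\in[n-1]:(\pi(i)-\pi(i-1))(\pi(i+1)-\pi(i))<0\}$ (e.g. $\mathrm{udrun}(623415)=5$). $T(n,k)$ is the number of $\pi\in\mathfrak{S}_n$ with $\mathrm{udrun}(\pi)=k$. -}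

module Defs where

open import Data.Nat as ℕ using (ℕ; zero; suc; _+_; _*_; _∸_; _^_)
open import Data.Integer as ℤ using (ℤ; +_; -_; ∣_∣)
open import Data.List using (List; []; _∷_; map; concatMap; filter; length; upTo; _++_)
open import Data.List.Relation.Unary.Unique.Propositional using (Unique)
open import Data.List.Relation.Unary.Unique.DecPropositional ℕ._≟_ using (unique?)
open import Data.Nat.ListAction using (sum)
open import Data.Bool using (Bool; true; false; _∨_; _∧_)
open import Relation.Nullary.Decidable using (⌊_⌋)

words : {A : Set} → ℕ → List A → List A → List (List A)
words zero    as acc = acc ∷ []
words (suc k) as acc = concatMap (λ a → words k as (acc ++ (a ∷ []))) as

allWords : {A : Set} → ℕ → List A → List (List A)
allWords k as = words k as []

range1 : ℕ → List ℕ
range1 n = map suc (upTo n)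

perms : ℕ → List (List ℕ)
perms n = filter (λ w → unique? w) (allWords n (range1 n))

-- Signed permutations of [n] (hyperoctahedral group 𝔖ᴮₙ), one-line notation:
-- words of length n over ±[n] whose absolute values are distinct.
signedAlphabet : ℕ → List ℤ
signedAlphabet n = map (λ i → + i) (range1 n) ++ map (λ i → - (+ i)) (range1 n)

signedPerms : ℕ → List (List ℤ)
signedPerms n = filter (λ w → unique? (map ∣_∣ w)) (allWords n (signedAlphabet n))

ind : Bool → ℕ
ind true  = 1
ind false = 0

descents : List ℤ → ℕ
descents []            = 0
descents (a ∷ [])      = 0
descents (a ∷ w@(b ∷ _)) = ind ⌊ b ℤ.<? a ⌋ + descents w

desA : List ℤ → ℕ
desA w = descents w

-- with the convention π(0) = 0
desB : List ℤ → ℕ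
desB w = descents (+ 0 ∷ w)

bEval : ℕ → ℕ → ℕ → ℕ
bEval n x y = sum (map (λ w → x ^ desA w * y ^ desB w) (signedPerms n))

turns : List ℕ → ℕ
turns (a ∷ w@(b ∷ c ∷ _)) =
  ind (⌊ a ℕ.<? b ⌋ ∧ ⌊ c ℕ.<? b ⌋ ∨ ⌊ b ℕ.<? a ⌋ ∧ ⌊ b ℕ.<? c ⌋) + turns w
turns _ = 0

-- udrun(π) = 1 + #{ i ∈ [n-1] : (π(i)-π(i-1))(π(i+1)-π(i)) < 0 }, with π(0) = 0
udrun : List ℕ → ℕ
udrun w = suc (turns (0 ∷ w))

T : ℕ → ℕ → ℕ
T n k = length (filter (λ w → udrun w ℕ.≟ k) (perms n))

ξ : ℕ → ℕ → ℕ
ξ n k = T n (1 + 2 * k)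

ζ : ℕ → ℕ → ℕ
ζ n k = 2 * T n (2 + 2 * k)

sumTo : ℕ → (ℕ → ℕ) → ℕ
sumTo m f = sum (map f (upTo (suc m)))

-- right-hand side evaluated at (x , y); the sums over k ≥ 0 are taken over
-- 0 ≤ k ≤ n, beyond which ξ(n,k) = ζ(n,k) = 0.
rhsEval : ℕ → ℕ → ℕ → ℕ
rhsEval n x y =
  (1 + y) * sumTo n (λ k → 4 ^ k * ξ n k * (x * y) ^ k * (1 + x * y) ^ (n ∸ 1 ∸ 2 * k))
  + y * (1 + x) * sumTo n (λ k → 4 ^ k * ζ n k * (x * y) ^ k * (1 + x * y) ^ (n ∸ 2 ∸ 2 * k))

{-# OPTIONS --safe #-}
module Submission where

-- For a signed permutation w with underlying permutation π = |w| we have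
-- desB w = desA w + [w(1) < 0], so b_n(x,y) = Σ_π Σ_signs (xy)^desA(w) y^[w(1) < 0].
-- Summing over the signs letter by letter, the partial sums starting with +a and with −a
-- differ exactly by the factor (xy)^[a is followed by a descent], so the 2×2 transfer step
-- collapses to one scalar factor per letter: π(1) contributes (xy)^[π(1) > π(2)] + y, and
-- every later letter contributes 2xy at a peak, 2 at a valley (the last letter counting as
-- a valley when it is reached by a descent) and 1 + xy otherwise.  So the sign sum of π
-- only depends on the direction d of the first step of π and on its number j of interior
-- turning points, and so does udrun π = 1 + [d = down] + j.
-- The complement π ↦ n + 1 − π flips d and keeps j, and for each j the contributions of
-- both directions add up to the right-hand-side weights of 1 + j and 2 + j runs.  Hence
-- pairing every π with its complement gives 2 b_n(x,y) = 2 · (right-hand side).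

open import Defs
open import Data.Bool using (Bool; true; false; not; _∧_; _∨_)
open import Data.Bool.Properties using (∨-comm; ∨-identityʳ)
open import Data.Integer as ℤ using (ℤ; -_; ∣_∣)
open import Data.Integer.Properties using (∣-i∣≡∣i∣)
open import Data.List
  using ( List; []; _∷_; map; concatMap; filter; length; reverse; upTo; applyUpTo
        ; applyDownFrom; _++_)
open import Data.List.Properties
  using ( map-cong; map-cong-local; map-∘; map-++; ++-assoc; ++-identityʳ; length-map
        ; map-upTo; map-applyUpTo; reverse-applyUpTo)
open import Data.List.Membership.Propositional using (_∈_)
open import Data.List.Membership.Propositional.Properties using (∈-map⁻; ∈-upTo⁻)
open import Data.List.Relation.Unary.All as All using (All; []; _∷_)
open import Data.List.Relation.Unary.All.Properties using () renaming (map⁺ to All-map⁺)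
open import Data.List.Relation.Unary.AllPairs using (_∷_)
open import Data.List.Relation.Unary.Unique.Propositional using (Unique)
import Data.List.Relation.Unary.Unique.Propositional.Properties as Unique
open import Data.List.Relation.Binary.Permutation.Propositional using (_↭_)
open import Data.List.Relation.Binary.Permutation.Propositional.Properties
  using (↭-reverse; map⁺)
open import Data.Nat as ℕ
  using ( ℕ; zero; suc; _+_; _*_; _∸_; _^_; _≤_; _<_; z≤n; s≤s; _≟_; _<?_
        ; ⌊_/2⌋; ⌈_/2⌉)
open import Data.Nat.Properties
open import Algebra.Properties.CommutativeSemigroup +-commutativeSemigroup
  using () renaming (interchange to +-interchange)
open import Data.List.Relation.Unary.Unique.DecPropositional ℕ._≟_ using (unique?)
open import Data.Nat.ListAction using (sum)
open import Data.Nat.ListAction.Properties using (sum-++; sum-↭)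
open import Data.Nat.Tactic.RingSolver using (solve-∀)
open import Data.Product using (_×_; _,_; proj₁; proj₂)
open import Function using (_∘_; _⇔_; mk⇔)
open import Relation.Nullary using (Dec; yes; no; does; contradiction)
open import Relation.Nullary.Decidable
  using (⌊_⌋; isYes≗does; dec-true; dec-false; does-⇔; ⌊⌋-map′)
open import Relation.Binary.PropositionalEquality
open ≡-Reasoning

private
  variable
    A B : Set

^-distribʳ-* : ∀ m n o → (m * n) ^ o ≡ m ^ o * n ^ o
^-distribʳ-* m n zero    = refl
^-distribʳ-* m n (suc o) = trans (cong (m * n *_) (^-distribʳ-* m n o)) (interchange m n _ _)
  where
  interchange : ∀ a b c d → a * b * (c * d) ≡ a * c * (b * d)
  interchange = solve-∀

^-suc-∸ : ∀ b {m e} → e ≤ m → b ^ (suc m ∸ e) ≡ b * b ^ (m ∸ e)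
^-suc-∸ b e≤m = cong (b ^_) (+-∸-assoc 1 e≤m)

^-ind-not : ∀ t β → t ^ ind (not β) * t ^ ind β ≡ t ^ 1
^-ind-not t true  = *-identityˡ (t ^ 1)
^-ind-not t false = *-identityʳ (t ^ 1)

data Parity : ℕ → Set where
  even : ∀ h → Parity (2 * h)
  odd  : ∀ h → Parity (1 + 2 * h)

parity : ∀ n → Parity n
parity zero = even 0
parity (suc n) with parity n
... | even h = odd h
... | odd h  = subst Parity (*-suc 2 h) (even (suc h))

⌊2*n/2⌋≡n : ∀ n → ⌊ 2 * n /2⌋ ≡ n
⌊2*n/2⌋≡n n =
  trans (cong (λ m → ⌊ n + m /2⌋) (+-identityʳ n)) (sym (n≡⌊n+n/2⌋ n))

⌊1+2*n/2⌋≡n : ∀ n → ⌊ 1 + 2 * n /2⌋ ≡ n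
⌊1+2*n/2⌋≡n zero    = refl
⌊1+2*n/2⌋≡n (suc n) =
  cong suc (trans (cong (λ m → ⌊ m /2⌋) (+-suc n (n + 0))) (⌊1+2*n/2⌋≡n n))

2*⌊n/2⌋≤n : ∀ n → 2 * ⌊ n /2⌋ ≤ n
2*⌊n/2⌋≤n zero          = z≤n
2*⌊n/2⌋≤n (suc zero)    = z≤n
2*⌊n/2⌋≤n (suc (suc n)) =
  subst (_≤ 2 + n) (sym (*-suc 2 ⌊ n /2⌋)) (s≤s (s≤s (2*⌊n/2⌋≤n n)))

c+2*h≤n⇒h≤n : ∀ c {h n} → c + 2 * h ≤ n → h ≤ n
c+2*h≤n⇒h≤n c {h} c+2h≤n =
  ≤-trans (m≤m+n h (h + 0)) (≤-trans (m≤n+m (2 * h) c) c+2h≤n)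

<?-flip : ∀ {a b} → a ≢ b → ⌊ b <? a ⌋ ≡ not ⌊ a <? b ⌋
<?-flip {a} {b} a≢b with a <? b | b <? a
... | yes a<b | yes b<a = contradiction b<a (<⇒≯ a<b)
... | yes _   | no  _   = refl
... | no  _   | yes _   = refl
... | no a≮b  | no b≮a  = contradiction (≤-antisym (≮⇒≥ b≮a) (≮⇒≥ a≮b)) a≢b

⌊⌋-⇔ : {P Q : Set} → P ⇔ Q → (P? : Dec P) (Q? : Dec Q) → ⌊ P? ⌋ ≡ ⌊ Q? ⌋
⌊⌋-⇔ P⇔Q P? Q? =
  trans (isYes≗does P?) (trans (does-⇔ P⇔Q P? Q?) (sym (isYes≗does Q?)))

ind-does-*-cong : {P : Set} (P? : Dec P) {m n : ℕ} → (P → m ≡ n) →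
                  ind (does P?) * m ≡ ind (does P?) * n
ind-does-*-cong (yes p) m≡n = cong (1 *_) (m≡n p)
ind-does-*-cong (no _)  m≡n = refl

sum-map-+ : (f g : A → ℕ) (xs : List A) →
            sum (map (λ a → f a + g a) xs) ≡ sum (map f xs) + sum (map g xs)
sum-map-+ f g []       = refl
sum-map-+ f g (a ∷ xs) =
  trans (cong ((f a + g a) +_) (sum-map-+ f g xs)) (+-interchange (f a) (g a) _ _)

sum-map-*ˡ : (c : ℕ) (f : A → ℕ) (xs : List A) →
             sum (map (λ a → c * f a) xs) ≡ c * sum (map f xs)
sum-map-*ˡ c f []       = sym (*-zeroʳ c)
sum-map-*ˡ c f (a ∷ xs) =
  trans (cong (c * f a +_) (sum-map-*ˡ c f xs)) (sym (*-distribˡ-+ c (f a) _))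

sum-map-≡0 : {f : A → ℕ} → (∀ a → f a ≡ 0) → (xs : List A) → sum (map f xs) ≡ 0
sum-map-≡0 f≡0 []       = refl
sum-map-≡0 f≡0 (a ∷ xs) = cong₂ _+_ (f≡0 a) (sum-map-≡0 f≡0 xs)

sum-map-comm : (g : A → B → ℕ) (xs : List A) (ys : List B) →
               sum (map (λ a → sum (map (g a) ys)) xs)
                 ≡ sum (map (λ b → sum (map (λ a → g a b) xs)) ys)
sum-map-comm g []       ys = sym (sum-map-≡0 (λ _ → refl) ys)
sum-map-comm g (a ∷ xs) ys =
  trans (cong (sum (map (g a) ys) +_) (sum-map-comm g xs ys)) (sym (sum-map-+ (g a) _ ys))

sum-concatMap : (f : B → ℕ) (g : A → List B) (xs : List A) →
                sum (map f (concatMap g xs)) ≡ sum (map (λ a → sum (map f (g a))) xs)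
sum-concatMap f g []       = refl
sum-concatMap f g (a ∷ xs) = begin
  sum (map f (g a ++ concatMap g xs))               ≡⟨ cong sum (map-++ f (g a) _) ⟩
  sum (map f (g a) ++ map f (concatMap g xs))       ≡⟨ sum-++ (map f (g a)) _ ⟩
  sum (map f (g a)) + sum (map f (concatMap g xs))  ≡⟨ cong (sum (map f (g a)) +_)
                                                            (sum-concatMap f g xs) ⟩
  sum (map (λ a → sum (map f (g a))) (a ∷ xs))      ∎

sum-map-filter : {P : A → Set} (P? : ∀ a → Dec (P a)) (f : A → ℕ) (xs : List A) →
                 sum (map f (filter P? xs)) ≡ sum (map (λ a → ind (does (P? a)) * f a) xs)
sum-map-filter P? f []       = refl
sum-map-filter P? f (a ∷ xs) with does (P? a)
... | true  = cong₂ _+_ (sym (+-identityʳ (f a))) (sum-map-filter P? f xs)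
... | false = sum-map-filter P? f xs

length-filter : {P : A → Set} (P? : ∀ a → Dec (P a)) (xs : List A) →
                length (filter P? xs) ≡ sum (map (λ a → ind (does (P? a))) xs)
length-filter P? []       = refl
length-filter P? (a ∷ xs) with does (P? a)
... | true  = cong suc (length-filter P? xs)
... | false = length-filter P? xs

sum-upTo-suc : ∀ N (F : ℕ → ℕ) →
               sum (map F (upTo (suc N))) ≡ F 0 + sum (map (F ∘ suc) (upTo N))
sum-upTo-suc N F = cong (λ xs → F 0 + sum xs) (begin
  map F (applyUpTo suc N)   ≡⟨ map-applyUpTo suc F N ⟩
  applyUpTo (F ∘ suc) N     ≡⟨ map-upTo (F ∘ suc) N ⟨
  map (F ∘ suc) (upTo N)    ∎)

sum-upTo-single : ∀ N (F : ℕ → ℕ) h → h < N → (∀ k → k ≢ h → F k ≡ 0) →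
                  sum (map F (upTo N)) ≡ F h
sum-upTo-single (suc N) F zero _ F≡0 = begin
  sum (map F (upTo (suc N)))
    ≡⟨ sum-upTo-suc N F ⟩
  F 0 + sum (map (F ∘ suc) (upTo N))
    ≡⟨ cong (F 0 +_) (sum-map-≡0 (λ k → F≡0 (suc k) λ ()) (upTo N)) ⟩
  F 0 + 0
    ≡⟨ +-identityʳ (F 0) ⟩
  F 0
    ∎
sum-upTo-single (suc N) F (suc h) 1+h<1+N F≡0 = begin
  sum (map F (upTo (suc N)))
    ≡⟨ sum-upTo-suc N F ⟩
  F 0 + sum (map (F ∘ suc) (upTo N))
    ≡⟨ cong₂ _+_ (F≡0 0 λ ())
                 (sum-upTo-single N (F ∘ suc) h (≤-pred 1+h<1+N) F∘suc≡0) ⟩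
  F (suc h)
    ∎
  where
  F∘suc≡0 : ∀ k → k ≢ h → F (suc k) ≡ 0
  F∘suc≡0 k k≢h = F≡0 (suc k) (k≢h ∘ suc-injective)

sumTo-select : ∀ n (g f : ℕ → ℕ) {h} → (∀ {k} → f k ≡ f h → k ≡ h) →
               h ≤ n → sumTo n (λ k → g k * ind (does (f h ≟ f k))) ≡ g h
sumTo-select n g f {h} f-injective h≤n = begin
  sumTo n (λ k → g k * ind (does (f h ≟ f k)))
    ≡⟨ sum-upTo-single (suc n) _ h (s≤s h≤n) off-h ⟩
  g h * ind (does (f h ≟ f h))
    ≡⟨ cong (λ β → g h * ind β) (dec-true (f h ≟ f h) refl) ⟩
  g h * 1
    ≡⟨ *-identityʳ (g h) ⟩
  g h
    ∎
  where
  off-h : ∀ k → k ≢ h → g k * ind (does (f h ≟ f k)) ≡ 0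
  off-h k k≢h = trans
    (cong (λ β → g k * ind β) (dec-false (f h ≟ f k) (k≢h ∘ f-injective ∘ sym)))
    (*-zeroʳ (g k))

sumTo-none : ∀ n (g f : ℕ → ℕ) {r} → (∀ k → r ≢ f k) →
             sumTo n (λ k → g k * ind (does (r ≟ f k))) ≡ 0
sumTo-none n g f {r} r≢f = sum-map-≡0 none (upTo (suc n))
  where
  none : ∀ k → g k * ind (does (r ≟ f k)) ≡ 0
  none k = trans (cong (λ β → g k * ind β) (dec-false (r ≟ f k) (r≢f k))) (*-zeroʳ (g k))

sumWords : ℕ → List A → (List A → ℕ) → ℕ
sumWords zero    as f = f []
sumWords (suc k) as f = sum (map (λ a → sumWords k as (λ w → f (a ∷ w))) as)

sumWords-cong : ∀ k (as : List A) {f g : List A → ℕ} → (∀ w → f w ≡ g w) →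
                sumWords k as f ≡ sumWords k as g
sumWords-cong zero    as f≡g = f≡g []
sumWords-cong (suc k) as f≡g =
  cong sum (map-cong (λ a → sumWords-cong k as (λ w → f≡g (a ∷ w))) as)

sumWords-cong-∈ : ∀ k (as : List A) {f g : List A → ℕ} →
                  (∀ w → All (_∈ as) w → length w ≡ k → f w ≡ g w) →
                  sumWords k as f ≡ sumWords k as g
sumWords-cong-∈ zero    as f≡g = f≡g [] [] refl
sumWords-cong-∈ (suc k) as f≡g = cong sum (map-cong-local (All.tabulate λ a∈as →
  sumWords-cong-∈ k as (λ w w⊆as |w|≡k → f≡g _ (a∈as ∷ w⊆as) (cong suc |w|≡k))))

sumWords-+ : ∀ k (as : List A) (f g : List A → ℕ) →
             sumWords k as (λ w → f w + g w) ≡ sumWords k as f + sumWords k as g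
sumWords-+ zero    as f g = refl
sumWords-+ (suc k) as f g = trans
  (cong sum (map-cong (λ a → sumWords-+ k as (λ w → f (a ∷ w)) (λ w → g (a ∷ w))) as))
  (sum-map-+ _ _ as)

sum-words : ∀ k (as acc : List A) (f : List A → ℕ) →
            sum (map f (words k as acc)) ≡ sumWords k as (λ w → f (acc ++ w))
sum-words zero    as acc f = trans (+-identityʳ _) (cong f (sym (++-identityʳ acc)))
sum-words (suc k) as acc f = begin
  sum (map f (concatMap (λ a → words k as (acc ++ a ∷ [])) as))
    ≡⟨ sum-concatMap f _ as ⟩
  sum (map (λ a → sum (map f (words k as (acc ++ a ∷ [])))) as)
    ≡⟨ cong sum (map-cong (λ a → trans (sum-words k as _ f)
                                       (sumWords-cong k as (cong f ∘ ++-assoc acc _))) as) ⟩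
  sumWords (suc k) as (λ w → f (acc ++ w))
    ∎

signSum : (List ℤ → ℕ) → List ℕ → ℕ
signSum f []      = f []
signSum f (a ∷ p) =
  signSum (λ w → f (ℤ.+ a ∷ w)) p + signSum (λ w → f (- ℤ.+ a ∷ w)) p

signSum-cong : ∀ p {f g : List ℤ → ℕ} → (∀ w → f w ≡ g w) →
               signSum f p ≡ signSum g p
signSum-cong []      f≡g = f≡g []
signSum-cong (a ∷ p) f≡g =
  cong₂ _+_ (signSum-cong p (f≡g ∘ _)) (signSum-cong p (f≡g ∘ _))

signSum-*ˡ : ∀ p (c : ℕ) (f : List ℤ → ℕ) →
             signSum (λ w → c * f w) p ≡ c * signSum f p
signSum-*ˡ []      c f = refl
signSum-*ˡ (a ∷ p) c f =
  trans (cong₂ _+_ (signSum-*ˡ p c _) (signSum-*ˡ p c _)) (sym (*-distribˡ-+ c _ _))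

signSum-factorˡ : ∀ p (c : List ℕ → ℕ) (f : List ℤ → ℕ) →
                  signSum (λ w → c (map ∣_∣ w) * f w) p ≡ c p * signSum f p
signSum-factorˡ []      c f = refl
signSum-factorˡ (a ∷ p) c f = begin
  Pos + signSum (λ w → c (∣ - ℤ.+ a ∣ ∷ map ∣_∣ w) * f (- ℤ.+ a ∷ w)) p
    ≡⟨ cong (Pos +_) (signSum-cong p λ w →
         cong (λ b → c (b ∷ map ∣_∣ w) * f (- ℤ.+ a ∷ w)) (∣-i∣≡∣i∣ (ℤ.+ a))) ⟩
  Pos + signSum (λ w → c (a ∷ map ∣_∣ w) * f (- ℤ.+ a ∷ w)) p
    ≡⟨ cong₂ _+_ (signSum-factorˡ p (c ∘ (a ∷_)) _) (signSum-factorˡ p (c ∘ (a ∷_)) _) ⟩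
  c (a ∷ p) * signSum (λ w → f (ℤ.+ a ∷ w)) p
    + c (a ∷ p) * signSum (λ w → f (- ℤ.+ a ∷ w)) p
    ≡⟨ *-distribˡ-+ (c (a ∷ p)) _ _ ⟨
  c (a ∷ p) * signSum f (a ∷ p)
    ∎
  where
  Pos = signSum (λ w → c (a ∷ map ∣_∣ w) * f (ℤ.+ a ∷ w)) p

sumWords-signedAlphabet : ∀ n k (f : List ℤ → ℕ) →
                          sumWords k (signedAlphabet n) f ≡ sumWords k (range1 n) (signSum f)
sumWords-signedAlphabet n zero    f = refl
sumWords-signedAlphabet n (suc k) f = begin
  sum (map G (map ℤ.+_ R ++ map (-_ ∘ ℤ.+_) R))
    ≡⟨ cong sum (map-++ G (map ℤ.+_ R) _) ⟩
  sum (map G (map ℤ.+_ R) ++ map G (map (-_ ∘ ℤ.+_) R))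
    ≡⟨ sum-++ (map G (map ℤ.+_ R)) _ ⟩
  sum (map G (map ℤ.+_ R)) + sum (map G (map (-_ ∘ ℤ.+_) R))
    ≡⟨ cong₂ _+_ (cong sum (map-∘ R)) (cong sum (map-∘ R)) ⟨
  sum (map (G ∘ ℤ.+_) R) + sum (map (G ∘ -_ ∘ ℤ.+_) R)
    ≡⟨ sum-map-+ (G ∘ ℤ.+_) (G ∘ -_ ∘ ℤ.+_) R ⟨
  sum (map (λ a → G (ℤ.+ a) + G (- ℤ.+ a)) R)
    ≡⟨ cong sum (map-cong (λ a → trans (cong₂ _+_ (sumWords-signedAlphabet n k _)
                                                   (sumWords-signedAlphabet n k _))
                                       (sym (sumWords-+ k R _ _))) R) ⟩
  sumWords (suc k) R (signSum f)
    ∎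
  where
  R = range1 n
  G : ℤ → ℕ
  G z = sumWords k (signedAlphabet n) (λ w → f (z ∷ w))

sumPerms : ℕ → (List ℕ → ℕ) → ℕ
sumPerms n f = sum (map f (perms n))

sumPerms≡sumWords : ∀ n (f : List ℕ → ℕ) →
                    sumPerms n f ≡ sumWords n (range1 n) (λ w → ind (does (unique? w)) * f w)
sumPerms≡sumWords n f =
  trans (sum-map-filter unique? f (allWords n (range1 n))) (sum-words n (range1 n) [] _)

sumPerms-cong : ∀ n {f g : List ℕ → ℕ} →
                (∀ w → All (_∈ range1 n) w → length w ≡ n → Unique w → f w ≡ g w) →
                sumPerms n f ≡ sumPerms n g
sumPerms-cong n {f} {g} f≡g = begin
  sumPerms n f
    ≡⟨ sumPerms≡sumWords n f ⟩
  sumWords n (range1 n) (λ w → ind (does (unique? w)) * f w)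
    ≡⟨ sumWords-cong-∈ n (range1 n) (λ w w⊆ |w|≡n →
         ind-does-*-cong (unique? w) (f≡g w w⊆ |w|≡n)) ⟩
  sumWords n (range1 n) (λ w → ind (does (unique? w)) * g w)
    ≡⟨ sumPerms≡sumWords n g ⟨
  sumPerms n g
    ∎

signedWeight : ℕ → ℕ → List ℕ → ℕ
signedWeight x y = signSum (λ w → x ^ desA w * y ^ desB w)

bEval≡sumPerms : ∀ n x y → bEval n x y ≡ sumPerms n (signedWeight x y)
bEval≡sumPerms n x y = begin
  bEval n x y
    ≡⟨ sum-map-filter (λ w → unique? (map ∣_∣ w)) F (allWords n (signedAlphabet n)) ⟩
  sum (map (λ w → ind (does (unique? (map ∣_∣ w))) * F w) (allWords n (signedAlphabet n)))
    ≡⟨ sum-words n (signedAlphabet n) [] _ ⟩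
  sumWords n (signedAlphabet n) (λ w → ind (does (unique? (map ∣_∣ w))) * F w)
    ≡⟨ sumWords-signedAlphabet n n _ ⟩
  sumWords n (range1 n) (signSum (λ w → ind (does (unique? (map ∣_∣ w))) * F w))
    ≡⟨ sumWords-cong n (range1 n) (λ p →
         signSum-factorˡ p (λ q → ind (does (unique? q))) F) ⟩
  sumWords n (range1 n) (λ p → ind (does (unique? p)) * signedWeight x y p)
    ≡⟨ sumPerms≡sumWords n (signedWeight x y) ⟨
  sumPerms n (signedWeight x y)
    ∎
  where
  F : List ℤ → ℕ
  F w = x ^ desA w * y ^ desB w

c*T≡sumPerms : ∀ n c r → c * T n r ≡ sumPerms n (λ w → c * ind (does (udrun w ≟ r)))
c*T≡sumPerms n c r = trans (cong (c *_) (length-filter (λ w → udrun w ≟ r) (perms n)))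
                           (sym (sum-map-*ˡ c _ (perms n)))

-- The complement a ↦ n + 1 − a

complement : ℕ → ℕ → ℕ
complement n a = suc n ∸ a

complement-involutive : ∀ {n a} → a ≤ n → complement n (complement n a) ≡ a
complement-involutive a≤n = m∸[m∸n]≡n (m≤n⇒m≤1+n a≤n)

complement-bounds : ∀ {n a} → 1 ≤ a × a ≤ n →
                    1 ≤ complement n a × complement n a ≤ n
complement-bounds {n} {suc a} (_ , 1+a≤n) = m<n⇒0<n∸m 1+a≤n , m∸n≤m n a

complement-<? : ∀ {n a b} → a ≤ n → b ≤ n →
                ⌊ complement n a <? complement n b ⌋ ≡ ⌊ b <? a ⌋
complement-<? {n} {a} {b} a≤n b≤n = ⌊⌋-⇔ (mk⇔ to from) _ _
  where
  to : complement n a < complement n b → b < a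
  to ca<cb = ≰⇒> (λ a≤b → <⇒≱ ca<cb (∸-monoʳ-≤ (suc n) a≤b))
  from : b < a → complement n a < complement n b
  from b<a = ∸-monoʳ-< b<a (m≤n⇒m≤1+n a≤n)

turns-complement : ∀ {n} w → All (_≤ n) w → turns (map (complement n) w) ≡ turns w
turns-complement []              _ = refl
turns-complement (a ∷ [])        _ = refl
turns-complement (a ∷ b ∷ [])    _ = refl
turns-complement (a ∷ b ∷ c ∷ w) (a≤n ∷ bcw≤n@(b≤n ∷ c≤n ∷ _)) =
  cong₂ _+_ (cong ind (begin
    ⌊ a′ <? b′ ⌋ ∧ ⌊ c′ <? b′ ⌋ ∨ ⌊ b′ <? a′ ⌋ ∧ ⌊ b′ <? c′ ⌋
      ≡⟨ cong₂ _∨_ (cong₂ _∧_ (complement-<? a≤n b≤n) (complement-<? c≤n b≤n))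
                   (cong₂ _∧_ (complement-<? b≤n a≤n) (complement-<? b≤n c≤n)) ⟩
    ⌊ b <? a ⌋ ∧ ⌊ b <? c ⌋ ∨ ⌊ a <? b ⌋ ∧ ⌊ c <? b ⌋
      ≡⟨ ∨-comm (⌊ b <? a ⌋ ∧ ⌊ b <? c ⌋) _ ⟩
    ⌊ a <? b ⌋ ∧ ⌊ c <? b ⌋ ∨ ⌊ b <? a ⌋ ∧ ⌊ b <? c ⌋
      ∎))
    (turns-complement (b ∷ c ∷ w) bcw≤n)
  where
  a′ = complement _ a
  b′ = complement _ b
  c′ = complement _ c

map-complement-involutive : ∀ {n} w → All (_≤ n) w →
                            map (complement n) (map (complement n) w) ≡ w
map-complement-involutive []      []          = refl
map-complement-involutive (a ∷ w) (a≤n ∷ w≤n) =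
  cong₂ _∷_ (complement-involutive a≤n) (map-complement-involutive w w≤n)

unique-complement : ∀ {n} w → All (_≤ n) w → Unique w → Unique (map (complement n) w)
unique-complement w w≤n u =
  Unique.map⁻ (subst Unique (sym (map-complement-involutive w w≤n)) u)

unique?-complement : ∀ {n} w → All (_≤ n) w →
                     does (unique? (map (complement n) w)) ≡ does (unique? w)
unique?-complement w w≤n =
  does-⇔ (mk⇔ Unique.map⁻ (unique-complement w w≤n)) (unique? _) (unique? w)

applyUpTo-∸ : ∀ n → applyUpTo (n ∸_) n ≡ applyDownFrom suc n
applyUpTo-∸ zero    = refl
applyUpTo-∸ (suc n) = cong (suc n ∷_) (applyUpTo-∸ n)

complement-range1-↭ : ∀ n → map (complement n) (range1 n) ↭ range1 n
complement-range1-↭ n =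
  subst₂ _↭_ (sym reversed) (sym (map-upTo suc n)) (↭-reverse (applyUpTo suc n))
  where
  reversed : map (complement n) (range1 n) ≡ reverse (applyUpTo suc n)
  reversed = begin
    map (complement n) (map suc (upTo n))  ≡⟨ cong (map (complement n)) (map-upTo suc n) ⟩
    map (complement n) (applyUpTo suc n)   ≡⟨ map-applyUpTo suc (complement n) n ⟩
    applyUpTo (n ∸_) n                     ≡⟨ applyUpTo-∸ n ⟩
    applyDownFrom suc n                    ≡⟨ reverse-applyUpTo suc n ⟨
    reverse (applyUpTo suc n)              ∎

sumWords-complement : ∀ n k (f : List ℕ → ℕ) →
  sumWords k (range1 n) (λ w → f (map (complement n) w)) ≡ sumWords k (range1 n) f
sumWords-complement n zero    f = refl
sumWords-complement n (suc k) f = begin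
  sum (map (λ a → sumWords k R (λ w → f (complement n a ∷ map (complement n) w))) R)
    ≡⟨ cong sum (map-cong (λ a →
         sumWords-complement n k (λ w → f (complement n a ∷ w))) R) ⟩
  sum (map (F ∘ complement n) R)
    ≡⟨ cong sum (map-∘ R) ⟩
  sum (map F (map (complement n) R))
    ≡⟨ sum-↭ (map⁺ F (complement-range1-↭ n)) ⟩
  sum (map F R)
    ∎
  where
  R = range1 n
  F : ℕ → ℕ
  F a = sumWords k R (λ w → f (a ∷ w))

∈-range1⁻ : ∀ {n a} → a ∈ range1 n → 1 ≤ a × a ≤ n
∈-range1⁻ a∈ with ∈-map⁻ suc a∈
... | i , i∈ , refl = s≤s z≤n , ∈-upTo⁻ i∈

sumPerms-complement : ∀ n (f : List ℕ → ℕ) →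
                      sumPerms n (λ w → f (map (complement n) w)) ≡ sumPerms n f
sumPerms-complement n f = begin
  sumPerms n (f ∘ map c)
    ≡⟨ sumPerms≡sumWords n (f ∘ map c) ⟩
  sumWords n R (λ w → ind (does (unique? w)) * f (map c w))
    ≡⟨ sumWords-cong-∈ n R (λ w w⊆R _ → cong (λ β → ind β * f (map c w))
         (sym (unique?-complement w (All.map (proj₂ ∘ ∈-range1⁻) w⊆R)))) ⟩
  sumWords n R (λ w → ind (does (unique? (map c w))) * f (map c w))
    ≡⟨ sumWords-complement n n (λ w → ind (does (unique? w)) * f w) ⟩
  sumWords n R (λ w → ind (does (unique? w)) * f w)
    ≡⟨ sumPerms≡sumWords n f ⟨
  sumPerms n f
    ∎
  where
  c = complement n
  R = range1 n

sumPerms-double : ∀ n (f : List ℕ → ℕ) →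
                  2 * sumPerms n f ≡ sumPerms n (λ w → f w + f (map (complement n) w))
sumPerms-double n f = begin
  sumPerms n f + (sumPerms n f + 0)
    ≡⟨ cong (sumPerms n f +_) (+-identityʳ _) ⟩
  sumPerms n f + sumPerms n f
    ≡⟨ cong (sumPerms n f +_) (sumPerms-complement n f) ⟨
  sumPerms n f + sumPerms n (λ w → f (map (complement n) w))
    ≡⟨ sum-map-+ f _ (perms n) ⟨
  sumPerms n (λ w → f w + f (map (complement n) w))
    ∎

-- The sign sum of a permutation as a product over its letters

descentAfter : ℕ → List ℕ → Bool
descentAfter a []      = false
descentAfter a (b ∷ _) = ⌊ b <? a ⌋

signProduct : ℕ → ℕ → List ℕ → ℕ
signProduct t a []      = 1
signProduct t a (b ∷ p) =
  (t ^ ind (descentAfter b p) + t ^ ind ⌊ a <? b ⌋) * signProduct t b p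

descentSignSum : ℕ → ℤ → List ℕ → ℕ
descentSignSum t z = signSum (λ w → t ^ descents (z ∷ w))

descentSignSum-cons : ∀ t z b p →
  descentSignSum t z (b ∷ p) ≡ t ^ ind ⌊ ℤ.+ b ℤ.<? z ⌋ * descentSignSum t (ℤ.+ b) p
                               + t ^ ind ⌊ - ℤ.+ b ℤ.<? z ⌋ * descentSignSum t (- ℤ.+ b) p
descentSignSum-cons t z b p = cong₂ _+_ (split (ℤ.+ b)) (split (- ℤ.+ b))
  where
  split : ∀ z′ → signSum (λ w → t ^ descents (z ∷ z′ ∷ w)) p
                 ≡ t ^ ind ⌊ z′ ℤ.<? z ⌋ * descentSignSum t z′ p
  split z′ = trans (signSum-cong p (λ w → ^-distribˡ-+-* t (ind ⌊ z′ ℤ.<? z ⌋) _))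
                   (signSum-*ˡ p (t ^ ind ⌊ z′ ℤ.<? z ⌋) _)

-- ⌊_⌋ does not compute on open terms, but `does` of both sides reduces to b <ᵇ a.
⌊-<?-⌋ : ∀ a b → ⌊ - ℤ.+ suc a ℤ.<? - ℤ.+ suc b ⌋ ≡ ⌊ suc b <? suc a ⌋
⌊-<?-⌋ a b = trans (isYes≗does _) (sym (isYes≗does (suc b <? suc a)))

descentSignSum-product : ∀ t {a} p → All (1 ≤_) (a ∷ p) → Unique (a ∷ p) →
  descentSignSum t (ℤ.+ a) p ≡ t ^ ind (descentAfter a p) * signProduct t a p
  × descentSignSum t (- ℤ.+ a) p ≡ signProduct t a p
descentSignSum-product t []      _ _ = refl , refl
descentSignSum-product t {suc a} (suc b ∷ p) (_ ∷ 1≤bp@(s≤s _ ∷ _)) ((a≢b ∷ _) ∷ u)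
  = positive , negative
  where
  β = ⌊ suc a <? suc b ⌋
  γ = ⌊ suc b <? suc a ⌋
  Q = signProduct t (suc b) p
  D = t ^ ind (descentAfter (suc b) p)
  P = descentSignSum t (ℤ.+ suc b) p
  M = descentSignSum t (- ℤ.+ suc b) p
  ih = descentSignSum-product t p 1≤bp u

  positive : descentSignSum t (ℤ.+ suc a) (suc b ∷ p) ≡ t ^ ind γ * ((D + t ^ ind β) * Q)
  positive = begin
    descentSignSum t (ℤ.+ suc a) (suc b ∷ p)
      ≡⟨ descentSignSum-cons t (ℤ.+ suc a) (suc b) p ⟩
    t ^ ind ⌊ ℤ.+ suc b ℤ.<? ℤ.+ suc a ⌋ * P + t ^ 1 * M
      ≡⟨ cong₂ (λ δ P′ → t ^ ind δ * P′ + t ^ 1 * M)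
               (⌊⌋-map′ _ _ (suc b <? suc a)) (proj₁ ih) ⟩
    t ^ ind γ * (D * Q) + t ^ 1 * M
      ≡⟨ cong₂ (λ e M′ → t ^ ind γ * (D * Q) + e * M′) (sym tγ*tβ≡t) (proj₂ ih) ⟩
    t ^ ind γ * (D * Q) + t ^ ind γ * t ^ ind β * Q
      ≡⟨ factor (t ^ ind γ) (t ^ ind β) D Q ⟩
    t ^ ind γ * ((D + t ^ ind β) * Q)
      ∎
    where
    tγ*tβ≡t : t ^ ind γ * t ^ ind β ≡ t ^ 1
    tγ*tβ≡t = trans (cong (λ δ → t ^ ind δ * t ^ ind β) (<?-flip a≢b)) (^-ind-not t β)
    factor : ∀ e f d q → e * (d * q) + e * f * q ≡ e * ((d + f) * q)
    factor = solve-∀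

  negative : descentSignSum t (- ℤ.+ suc a) (suc b ∷ p) ≡ (D + t ^ ind β) * Q
  negative = begin
    descentSignSum t (- ℤ.+ suc a) (suc b ∷ p)
      ≡⟨ descentSignSum-cons t (- ℤ.+ suc a) (suc b) p ⟩
    1 * P + t ^ ind ⌊ - ℤ.+ suc b ℤ.<? - ℤ.+ suc a ⌋ * M
      ≡⟨ cong₂ (λ P′ δ → 1 * P′ + t ^ ind δ * M) (proj₁ ih) (⌊-<?-⌋ b a) ⟩
    1 * (D * Q) + t ^ ind β * M
      ≡⟨ cong₂ (λ P′ M′ → P′ + t ^ ind β * M′) (*-identityˡ (D * Q)) (proj₂ ih) ⟩
    D * Q + t ^ ind β * Q
      ≡⟨ *-distribʳ-+ Q D (t ^ ind β) ⟨
    (D + t ^ ind β) * Q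
      ∎

signedWeight-cons : ∀ x y {a} p → All (1 ≤_) (a ∷ p) → Unique (a ∷ p) →
  signedWeight x y (a ∷ p) ≡ ((x * y) ^ ind (descentAfter a p) + y) * signProduct (x * y) a p
signedWeight-cons x y {suc a} p 1≤ap@(s≤s _ ∷ _) u = begin
  signSum (λ w → x ^ D⁺ w * y ^ D⁺ w) p + signSum (λ w → x ^ D⁻ w * y ^ suc (D⁻ w)) p
    ≡⟨ cong₂ _+_ (signSum-cong p λ w → sym (^-distribʳ-* x y (D⁺ w)))
                 (trans (signSum-cong p λ w → x^d*y^[1+d] (D⁻ w)) (signSum-*ˡ p y _)) ⟩
  descentSignSum t (ℤ.+ suc a) p + y * descentSignSum t (- ℤ.+ suc a) p
    ≡⟨ cong₂ (λ P M → P + y * M) (proj₁ ih) (proj₂ ih) ⟩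
  t ^ ind (descentAfter (suc a) p) * Q + y * Q
    ≡⟨ *-distribʳ-+ Q (t ^ ind (descentAfter (suc a) p)) y ⟨
  (t ^ ind (descentAfter (suc a) p) + y) * Q
    ∎
  where
  t = x * y
  Q = signProduct t (suc a) p
  D⁺ D⁻ : List ℤ → ℕ
  D⁺ w = descents (ℤ.+ suc a ∷ w)
  D⁻ w = descents (- ℤ.+ suc a ∷ w)
  ih = descentSignSum-product t p 1≤ap u
  x^d*y^[1+d] : ∀ d → x ^ d * (y * y ^ d) ≡ y * t ^ d
  x^d*y^[1+d] d = trans (swap (x ^ d) y (y ^ d)) (cong (y *_) (sym (^-distribʳ-* x y d)))
    where
    swap : ∀ a b c → a * (b * c) ≡ b * (a * c)
    swap = solve-∀

-- Closed form of the product

oddRunWeight : ℕ → ℕ → ℕ → ℕ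
oddRunWeight n t k = 4 ^ k * t ^ k * (1 + t) ^ (n ∸ 1 ∸ 2 * k)

evenRunWeight : ℕ → ℕ → ℕ → ℕ
evenRunWeight n t k = 2 * 4 ^ k * t ^ k * (1 + t) ^ (n ∸ 2 ∸ 2 * k)

oddRunWeight-suc : ∀ t {n k} → 1 + 2 * k ≤ n →
                   (1 + t) * oddRunWeight n t k ≡ oddRunWeight (suc n) t k
oddRunWeight-suc t {suc m} {k} (s≤s 2k≤m) =
  trans (reassoc (4 ^ k) (t ^ k) (1 + t) _)
        (cong (4 ^ k * t ^ k *_) (sym (^-suc-∸ (1 + t) 2k≤m)))
  where
  reassoc : ∀ a b c e → c * (a * b * e) ≡ a * b * (c * e)
  reassoc = solve-∀

evenRunWeight-suc : ∀ t {n k} → 2 + 2 * k ≤ n →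
                    (1 + t) * evenRunWeight n t k ≡ evenRunWeight (suc n) t k
evenRunWeight-suc t {suc (suc m)} {k} (s≤s (s≤s 2k≤m)) =
  trans (reassoc (4 ^ k) (t ^ k) (1 + t) _)
        (cong (2 * 4 ^ k * t ^ k *_) (sym (^-suc-∸ (1 + t) 2k≤m)))
  where
  reassoc : ∀ a b c e → c * (2 * a * b * e) ≡ 2 * a * b * (c * e)
  reassoc = solve-∀

evenRunWeight-peak : ∀ t n k → 2 * t * evenRunWeight n t k ≡ oddRunWeight (suc n) t (suc k)
evenRunWeight-peak t n k = begin
  2 * t * (2 * 4 ^ k * t ^ k * (1 + t) ^ (n ∸ 2 ∸ 2 * k))
    ≡⟨ reassoc (4 ^ k) t (t ^ k) _ ⟩
  4 ^ suc k * t ^ suc k * (1 + t) ^ (n ∸ 2 ∸ 2 * k)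
    ≡⟨ cong (λ e → 4 ^ suc k * t ^ suc k * (1 + t) ^ e) exponent ⟩
  oddRunWeight (suc n) t (suc k)
    ∎
  where
  reassoc : ∀ a t b e → 2 * t * (2 * a * b * e) ≡ 4 * a * (t * b) * e
  reassoc = solve-∀
  exponent : n ∸ 2 ∸ 2 * k ≡ n ∸ 2 * suc k
  exponent = trans (∸-+-assoc n 2 (2 * k)) (cong (n ∸_) (sym (*-suc 2 k)))

oddRunWeight-valley : ∀ t n k → 2 * oddRunWeight n t k ≡ evenRunWeight (suc n) t k
oddRunWeight-valley t n k = reassoc (4 ^ k) (t ^ k) _
  where
  reassoc : ∀ a b e → 2 * (a * b * e) ≡ 2 * a * b * e
  reassoc = solve-∀

-- A word whose first step is a descent (d) resp. an ascent (¬ d) and which has j interior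
-- turning points has ⌊j/2⌋ peaks and ⌊j/2⌋ + 1 valleys resp. ⌈j/2⌉ peaks and ⌈j/2⌉
-- valleys, counting the last letter as a valley when it ends a descent.
closedSignProduct : ℕ → ℕ → Bool → ℕ → ℕ
closedSignProduct n t false j = oddRunWeight n t ⌈ j /2⌉
closedSignProduct n t true  j = evenRunWeight n t ⌊ j /2⌋

closedSignProduct-base : ∀ t β → (1 + t ^ ind β) * 1 ≡ closedSignProduct 2 t (not β) 0
closedSignProduct-base t true  = normalise t
  where
  normalise : ∀ t → (1 + t * 1) * 1 ≡ 1 * 1 * ((1 + t) * 1)
  normalise = solve-∀
closedSignProduct-base t false = refl

-- β and γ decide a < b and b < c for three consecutive letters a b c; the four cases
-- are an ascent run, a peak at b, a valley at b and a descent run.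
closedSignProduct-step : ∀ t {n j} (β γ : Bool) → 2 + j ≤ n →
  (t ^ ind (not γ) + t ^ ind β) * closedSignProduct n t (not γ) j
    ≡ closedSignProduct (suc n) t (not β) (ind (β ∧ not γ ∨ not β ∧ γ) + j)
closedSignProduct-step t {n} {j} true true 2+j≤n = trans
  (cong (λ u → (1 + u) * oddRunWeight n t ⌈ j /2⌉) (*-identityʳ t))
  (oddRunWeight-suc t {k = ⌈ j /2⌉} (≤-trans (s≤s (2*⌊n/2⌋≤n (suc j))) 2+j≤n))
closedSignProduct-step t {n} {j} true false _ = trans
  (cong (_* evenRunWeight n t ⌊ j /2⌋) (t*1+t*1≡2*t t))
  (evenRunWeight-peak t n ⌊ j /2⌋)
  where
  t*1+t*1≡2*t : ∀ t → t * 1 + t * 1 ≡ 2 * t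
  t*1+t*1≡2*t = solve-∀
closedSignProduct-step t {n} {j} false true _ = oddRunWeight-valley t n ⌈ j /2⌉
closedSignProduct-step t {n} {j} false false 2+j≤n = trans
  (cong (_* evenRunWeight n t ⌊ j /2⌋) (trans (cong (_+ 1) (*-identityʳ t)) (+-comm t 1)))
  (evenRunWeight-suc t {k = ⌊ j /2⌋} (≤-trans (+-monoʳ-≤ 2 (2*⌊n/2⌋≤n j)) 2+j≤n))

2+turns≤length : ∀ a b p → 2 + turns (a ∷ b ∷ p) ≤ length (a ∷ b ∷ p)
2+turns≤length a b []      = s≤s (s≤s z≤n)
2+turns≤length a b (c ∷ p) = s≤s (s≤s (≤-trans
  (+-monoˡ-≤ (turns (b ∷ c ∷ p)) (ind≤1 _))
  (≤-pred (2+turns≤length b c p))))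
  where
  ind≤1 : ∀ β → ind β ≤ 1
  ind≤1 true  = ≤-refl
  ind≤1 false = z≤n

signProduct-closed : ∀ t a b p → Unique (a ∷ b ∷ p) →
  signProduct t a (b ∷ p) ≡ closedSignProduct (length (a ∷ b ∷ p)) t
                                                (descentAfter a (b ∷ p)) (turns (a ∷ b ∷ p))
signProduct-closed t a b [] ((a≢b ∷ _) ∷ _)
  rewrite <?-flip a≢b = closedSignProduct-base t ⌊ a <? b ⌋
signProduct-closed t a b (c ∷ p) ((a≢b ∷ _) ∷ u@((b≢c ∷ _) ∷ _))
  rewrite signProduct-closed t b c p u | <?-flip a≢b | <?-flip b≢c =
  closedSignProduct-step t ⌊ a <? b ⌋ ⌊ b <? c ⌋ (2+turns≤length b c p)

-- The right-hand side as a sum over permutations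

runWeight : ℕ → ℕ → ℕ → ℕ → ℕ
runWeight n x y r =
  (1 + y) * sumTo n (λ k → oddRunWeight n (x * y) k * ind (does (r ≟ 1 + 2 * k)))
  + y * (1 + x) * sumTo n (λ k → evenRunWeight n (x * y) k * ind (does (r ≟ 2 + 2 * k)))

runWeight-odd : ∀ n x y h → h ≤ n →
                runWeight n x y (1 + 2 * h) ≡ (1 + y) * oddRunWeight n (x * y) h
runWeight-odd n x y h h≤n = begin
  runWeight n x y (1 + 2 * h)
    ≡⟨ cong₂ (λ u v → (1 + y) * u + y * (1 + x) * v)
         (sumTo-select n (oddRunWeight n (x * y)) (λ k → 1 + 2 * k)
                       (*-cancelˡ-≡ _ _ 2 ∘ suc-injective) h≤n)
         (sumTo-none n (evenRunWeight n (x * y)) (λ k → 2 + 2 * k)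
                     (λ k → even≢odd h k ∘ suc-injective)) ⟩
  (1 + y) * oddRunWeight n (x * y) h + y * (1 + x) * 0
    ≡⟨ cong ((1 + y) * oddRunWeight n (x * y) h +_) (*-zeroʳ (y * (1 + x))) ⟩
  (1 + y) * oddRunWeight n (x * y) h + 0
    ≡⟨ +-identityʳ _ ⟩
  (1 + y) * oddRunWeight n (x * y) h
    ∎

runWeight-even : ∀ n x y h → h ≤ n →
                 runWeight n x y (2 + 2 * h) ≡ y * (1 + x) * evenRunWeight n (x * y) h
runWeight-even n x y h h≤n = begin
  runWeight n x y (2 + 2 * h)
    ≡⟨ cong₂ (λ u v → (1 + y) * u + y * (1 + x) * v)
         (sumTo-none n (oddRunWeight n (x * y)) (λ k → 1 + 2 * k)
                     (λ k → even≢odd k h ∘ sym ∘ suc-injective))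
         (sumTo-select n (evenRunWeight n (x * y)) (λ k → 2 + 2 * k)
                       (*-cancelˡ-≡ _ _ 2 ∘ suc-injective ∘ suc-injective) h≤n) ⟩
  (1 + y) * 0 + y * (1 + x) * evenRunWeight n (x * y) h
    ≡⟨ cong (_+ y * (1 + x) * evenRunWeight n (x * y) h) (*-zeroʳ (1 + y)) ⟩
  y * (1 + x) * evenRunWeight n (x * y) h
    ∎

rhsEval≡sumPerms : ∀ n x y → rhsEval n x y ≡ sumPerms n (λ w → runWeight n x y (udrun w))
rhsEval≡sumPerms n x y = begin
  rhsEval n x y
    ≡⟨ cong₂ (λ u v → (1 + y) * u + y * (1 + x) * v)
             (cong sum (map-cong odd-summand K)) (cong sum (map-cong even-summand K)) ⟩
  (1 + y) * sum (map (λ k → sumPerms n (Odd k)) K)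
    + y * (1 + x) * sum (map (λ k → sumPerms n (Even k)) K)
    ≡⟨ cong₂ (λ u v → (1 + y) * u + y * (1 + x) * v)
             (sum-map-comm Odd K (perms n)) (sum-map-comm Even K (perms n)) ⟩
  (1 + y) * sumPerms n (λ w → sum (map (λ k → Odd k w) K))
    + y * (1 + x) * sumPerms n (λ w → sum (map (λ k → Even k w) K))
    ≡⟨ cong₂ _+_ (sum-map-*ˡ (1 + y) _ (perms n)) (sum-map-*ˡ (y * (1 + x)) _ (perms n)) ⟨
  sumPerms n (λ w → (1 + y) * sum (map (λ k → Odd k w) K))
    + sumPerms n (λ w → y * (1 + x) * sum (map (λ k → Even k w) K))
    ≡⟨ sum-map-+ _ _ (perms n) ⟨
  sumPerms n (λ w → runWeight n x y (udrun w))
    ∎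
  where
  t = x * y
  K = upTo (suc n)
  Odd Even : ℕ → List ℕ → ℕ
  Odd  k w = oddRunWeight n t k * ind (does (udrun w ≟ 1 + 2 * k))
  Even k w = evenRunWeight n t k * ind (does (udrun w ≟ 2 + 2 * k))

  odd-summand : ∀ k → 4 ^ k * ξ n k * t ^ k * (1 + t) ^ (n ∸ 1 ∸ 2 * k)
                      ≡ sumPerms n (Odd k)
  odd-summand k = trans (reorder (4 ^ k) (ξ n k) (t ^ k) _)
                        (c*T≡sumPerms n (oddRunWeight n t k) (1 + 2 * k))
    where
    reorder : ∀ a s b e → a * s * b * e ≡ a * b * e * s
    reorder = solve-∀

  even-summand : ∀ k → 4 ^ k * ζ n k * t ^ k * (1 + t) ^ (n ∸ 2 ∸ 2 * k)
                       ≡ sumPerms n (Even k)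
  even-summand k = trans (reorder (4 ^ k) (T n (2 + 2 * k)) (t ^ k) _)
                         (c*T≡sumPerms n (evenRunWeight n t k) (2 + 2 * k))
    where
    reorder : ∀ a s b e → a * (2 * s) * b * e ≡ 2 * a * b * e * s
    reorder = solve-∀

-- Pairing a permutation with its complement

shapeWeight : ℕ → ℕ → ℕ → Bool → ℕ → ℕ
shapeWeight n x y d j = ((x * y) ^ ind d + y) * closedSignProduct n (x * y) d j

-- For even j each shape weight equals the run weight of its own number of runs; for odd j
-- the two shapes (with 1 + j and 2 + j runs) carry each other's run weight.
shapeWeight-pair : ∀ n x y d {j} → 2 + j ≤ n →
  shapeWeight n x y d j + shapeWeight n x y (not d) j
    ≡ runWeight n x y (1 + ind d + j) + runWeight n x y (1 + ind (not d) + j)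
shapeWeight-pair n x y true {j} 2+j≤n =
  trans (+-comm (shapeWeight n x y true j) _)
        (trans (shapeWeight-pair n x y false 2+j≤n) (+-comm (runWeight n x y (1 + j)) _))
shapeWeight-pair n x y false {j} 2+j≤n with parity j
... | even h = begin
  (1 + y) * oddRunWeight n t ⌈ 2 * h /2⌉ + (t * 1 + y) * evenRunWeight n t ⌊ 2 * h /2⌋
    ≡⟨ cong₂ (λ k l → (1 + y) * oddRunWeight n t k + (t * 1 + y) * evenRunWeight n t l)
             (⌊1+2*n/2⌋≡n h) (⌊2*n/2⌋≡n h) ⟩
  (1 + y) * oddRunWeight n t h + (t * 1 + y) * evenRunWeight n t h
    ≡⟨ cong (λ c → (1 + y) * oddRunWeight n t h + c * evenRunWeight n t h)
            (xy*1+y≡y[1+x] x y) ⟩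
  (1 + y) * oddRunWeight n t h + y * (1 + x) * evenRunWeight n t h
    ≡⟨ cong₂ _+_ (runWeight-odd n x y h h≤n) (runWeight-even n x y h h≤n) ⟨
  runWeight n x y (1 + 2 * h) + runWeight n x y (2 + 2 * h)
    ∎
  where
  t = x * y
  h≤n = c+2*h≤n⇒h≤n 2 2+j≤n
  xy*1+y≡y[1+x] : ∀ x y → x * y * 1 + y ≡ y * (1 + x)
  xy*1+y≡y[1+x] = solve-∀
... | odd h = begin
  (1 + y) * oddRunWeight n t ⌈ 1 + 2 * h /2⌉
    + (t * 1 + y) * evenRunWeight n t ⌊ 1 + 2 * h /2⌋
    ≡⟨ cong₂ (λ k l → (1 + y) * oddRunWeight n t (suc k)
                      + (t * 1 + y) * evenRunWeight n t l)
             (⌊2*n/2⌋≡n h) (⌊1+2*n/2⌋≡n h) ⟩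
  (1 + y) * oddRunWeight n t (suc h) + (t * 1 + y) * evenRunWeight n t h
    ≡⟨ cong (λ c → (1 + y) * oddRunWeight n t (suc h) + c * evenRunWeight n t h)
            (xy*1+y≡y[1+x] x y) ⟩
  (1 + y) * oddRunWeight n t (suc h) + y * (1 + x) * evenRunWeight n t h
    ≡⟨ +-comm _ (y * (1 + x) * evenRunWeight n t h) ⟩
  y * (1 + x) * evenRunWeight n t h + (1 + y) * oddRunWeight n t (suc h)
    ≡⟨ cong₂ _+_ (runWeight-even n x y h h≤n) (runWeight-odd n x y (suc h) 1+h≤n) ⟨
  runWeight n x y (2 + 2 * h) + runWeight n x y (1 + 2 * suc h)
    ≡⟨ cong (λ m → runWeight n x y (2 + 2 * h) + runWeight n x y (1 + m)) (*-suc 2 h) ⟩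
  runWeight n x y (2 + 2 * h) + runWeight n x y (3 + 2 * h)
    ∎
  where
  t = x * y
  h≤n = c+2*h≤n⇒h≤n 3 2+j≤n
  1+h≤n = c+2*h≤n⇒h≤n 1 (subst (λ m → 1 + m ≤ n) (sym (*-suc 2 h)) 2+j≤n)
  xy*1+y≡y[1+x] : ∀ x y → x * y * 1 + y ≡ y * (1 + x)
  xy*1+y≡y[1+x] = solve-∀

udrun-shape : ∀ {a} b p → 1 ≤ a →
              udrun (a ∷ b ∷ p) ≡ 1 + ind (descentAfter a (b ∷ p)) + turns (a ∷ b ∷ p)
udrun-shape {suc a} b p _ =
  cong (λ β → suc (ind β + turns (suc a ∷ b ∷ p))) (∨-identityʳ ⌊ b <? suc a ⌋)

signedWeight-shape : ∀ x y a b p → All (1 ≤_) (a ∷ b ∷ p) → Unique (a ∷ b ∷ p) →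
  signedWeight x y (a ∷ b ∷ p)
    ≡ shapeWeight (length (a ∷ b ∷ p)) x y (descentAfter a (b ∷ p)) (turns (a ∷ b ∷ p))
signedWeight-shape x y a b p 1≤w u = trans
  (signedWeight-cons x y (b ∷ p) 1≤w u)
  (cong (((x * y) ^ ind (descentAfter a (b ∷ p)) + y) *_) (signProduct-closed (x * y) a b p u))

signedWeight-complement-pair : ∀ n x y w → 2 ≤ n → length w ≡ n →
  All (λ a → 1 ≤ a × a ≤ n) w → Unique w →
  signedWeight x y w + signedWeight x y (map (complement n) w)
    ≡ runWeight n x y (udrun w) + runWeight n x y (udrun (map (complement n) w))
signedWeight-complement-pair .0 _ _ []       ()       refl _ _
signedWeight-complement-pair .1 _ _ (_ ∷ []) (s≤s ()) refl _ _
signedWeight-complement-pair _ x y w@(a ∷ b ∷ p) _ refl bounds u@((a≢b ∷ _) ∷ _) = begin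
  signedWeight x y w + signedWeight x y w̄
    ≡⟨ cong₂ _+_ (signedWeight-shape x y a b p (All.map proj₁ bounds) u)
                 (signedWeight-shape x y (c a) (c b) (map c p) (All.map proj₁ bounds̄) ū) ⟩
  shapeWeight n x y d j + shapeWeight (length w̄) x y d̄ (turns w̄)
    ≡⟨ cong (shapeWeight n x y d j +_)
            (trans (cong₂ (λ m e → shapeWeight m x y e (turns w̄)) |w̄|≡n d̄≡¬d)
                   (cong (shapeWeight n x y (not d)) j̄≡j)) ⟩
  shapeWeight n x y d j + shapeWeight n x y (not d) j
    ≡⟨ shapeWeight-pair n x y d (2+turns≤length a b p) ⟩
  runWeight n x y (1 + ind d + j) + runWeight n x y (1 + ind (not d) + j)
    ≡⟨ cong₂ (λ r r̄ → runWeight n x y r + runWeight n x y r̄) udrun-w udrun-w̄ ⟨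
  runWeight n x y (udrun w) + runWeight n x y (udrun w̄)
    ∎
  where
  n = length w
  c = complement n
  w̄ = map c w
  d = descentAfter a (b ∷ p)
  d̄ = descentAfter (c a) (c b ∷ map c p)
  j = turns w
  w≤n = All.map proj₂ bounds
  bounds̄ : All (λ a → 1 ≤ a × a ≤ n) w̄
  bounds̄ = All-map⁺ (All.map complement-bounds bounds)
  ū = unique-complement w w≤n u
  |w̄|≡n : length w̄ ≡ n
  |w̄|≡n = cong (suc ∘ suc) (length-map c p)
  d̄≡¬d : d̄ ≡ not d
  d̄≡¬d = trans (complement-<? (All.head (All.tail w≤n)) (All.head w≤n))
               (<?-flip (a≢b ∘ sym))
  j̄≡j : turns w̄ ≡ j
  j̄≡j = turns-complement w w≤n
  udrun-w : udrun w ≡ 1 + ind d + j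
  udrun-w = udrun-shape b p (proj₁ (All.head bounds))
  udrun-w̄ : udrun w̄ ≡ 1 + ind (not d) + j
  udrun-w̄ = trans (udrun-shape (c b) (map c p) (proj₁ (All.head bounds̄)))
                  (cong₂ (λ e i → 1 + ind e + i) d̄≡¬d j̄≡j)

theorem1 : (n : ℕ) → 2 ≤ n → (x y : ℕ) → bEval n x y ≡ rhsEval n x y
theorem1 n 2≤n x y = *-cancelˡ-≡ (bEval n x y) (rhsEval n x y) 2 (begin
  2 * bEval n x y
    ≡⟨ cong (2 *_) (bEval≡sumPerms n x y) ⟩
  2 * sumPerms n (signedWeight x y)
    ≡⟨ sumPerms-double n (signedWeight x y) ⟩
  sumPerms n (λ w → signedWeight x y w + signedWeight x y (map (complement n) w))
    ≡⟨ sumPerms-cong n (λ w w⊆[1,n] |w|≡n u →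
         signedWeight-complement-pair n x y w 2≤n |w|≡n (All.map ∈-range1⁻ w⊆[1,n]) u) ⟩
  sumPerms n (λ w → R w + R (map (complement n) w))
    ≡⟨ sumPerms-double n R ⟨
  2 * sumPerms n R
    ≡⟨ cong (2 *_) (rhsEval≡sumPerms n x y) ⟨
  2 * rhsEval n x y
    ∎)
  where
  R : List ℕ → ℕ
  R w = runWeight n x y (udrun w)
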